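{- Let $\mathcal U$ be a class of computational problems and $k\in\mathbb N$. (1) If $\mathcal U$ admits an exact level-$k$ transport basis $\mathcal B_k(\mathcal U)$ containing two members that are pairwise exact-$k$ transport-incompatible in $\mathcal U$, then $\mathcal O_k(\mathcal U)$ is not principal. (2) If $\mathcal O_k(\mathcal U)$ contains an infinite family that is pairwise exact-$k$ transport-incompatible, then $\mathcal U$ admits no finite exact level-$k$ transport basis.
   Context: A computational problem is $(\Xi,\Omega,(\mathcal M,d),\Lambda)$ with $\Xi:\Omega\to\mathcal M$ into a metric space and $\Lambda$ a set of functions $\Omega\to\mathbb C$ separating inputs with different $\Xi$-values; $\operatorname{SCI}_G$ denotes its type-$G$ solvability complexity index (least height of a tower of finite-query general algorithms whose iterated pointwise limits compute $\Xi$). For $\mathcal S=(\Psi,\Sigma,(\mathcal N,\rho),\Lambda_{\mathcal S})$, $\mathcal P=(\Xi,\Omega,(\mathcal M,d),\Lambda_{\mathcal P})$, $\mathcal S\le_{G,\mathrm{fq}}\mathcal P$ means there exist $E:\Sigma\to\Omega$, a continuous $D:\mathcal M\to\mathcal N$ and for each $f\in\Lambda_{\mathcal P}$ some $m_f\in\{1,2,\dots\}$, $\gamma_{f,j}\in\Lambda_{\mathcal S}$ and $\vartheta_f:\operatorname{im}(\gamma_{f,1},\dots,\gamma_{f,m_f})\to\mathbb C$ with $\Psi=D\circ\Xi\circ E$ and $f(E(A))=\vartheta_f(\gamma_{f,1}(A),\dots,\gamma_{f,m_f}(A))$ for all $A$. Definitions: $\mathcal O_k(\mathcal U)=\{\mathcal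 P\in\mathcal U:\operatorname{SCI}_G(\mathcal P)=k\}$. A class $\mathcal B_k(\mathcal U)\subseteq\mathcal U$ is an exact level-$k$ transport basis over $\mathcal U$ if every $\mathcal O\in\mathcal B_k(\mathcal U)$ has $\operatorname{SCI}_G(\mathcal O)=k$ and $\mathcal O_k(\mathcal U)=\{\mathcal P\in\mathcal U:\exists\mathcal O\in\mathcal B_k(\mathcal U),\ \mathcal O\le_{G,\mathrm{fq}}\mathcal P\}$. $\mathcal O_k(\mathcal U)$ is principal if there is $\mathcal S_k\in\mathcal U$ with $\operatorname{SCI}_G(\mathcal S_k)=k$ and $\mathcal O_k(\mathcal U)=\{\mathcal P\in\mathcal U:\mathcal S_k\le_{G,\mathrm{fq}}\mathcal P\}$. Two problems $\mathcal O_0,\mathcal O_1\in\mathcal U$ are pairwise exact-$k$ transport-incompatible in $\mathcal U$ if both have $\operatorname{SCI}_G=k$ and there is no $\mathcal S\in\mathcal U$ with $\operatorname{SCI}_G(\mathcal S)=k$, $\mathcal S\le_{G,\mathrm{fq}}\mathcal O_0$ and $\mathcal S\le_{G,\mathrm{fq}}\mathcal O_1$; a family is pairwise exact-$k$ transport-incompatible if all members have $\operatorname{SCI}_G=k$ and every pair of distinct members is. -}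

module Defs where

open import Level using (Level; _⊔_; suc)
open import Data.Nat using (ℕ)
open import Data.Product using (Σ; ∃; _×_; _,_)
open import Data.List using (List)
open import Data.List.Membership.Propositional using (_∈_)
open import Relation.Nullary using (¬_)
open import Relation.Binary.PropositionalEquality using (_≡_; _≢_)
open import Function.Bundles using (_⇔_)

record ProblemTheory (a r s : Level) : Set (suc (a ⊔ r ⊔ s)) where
  field
    Problem : Set a
    _≤fq_   : Problem → Problem → Set r
    SCIis   : Problem → ℕ → Set s

module _ {a r s : Level} (T : ProblemTheory a r s) where
  open ProblemTheory T

  Class : (u : Level) → Set (a ⊔ suc u)
  Class u = Problem → Set u

  O : ∀ {u} → ℕ → Class u → Class (u ⊔ s)
  O k U P = U P × SCIis P k

  IsExactBasis : ∀ {u b} → Class u → ℕ → Class b → Set (a ⊔ r ⊔ s ⊔ u ⊔ b)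
  IsExactBasis U k B =
      (∀ P → B P → U P)
    × (∀ P → B P → SCIis P k)
    × (∀ P → O k U P ⇔ (U P × (Σ Problem λ Q → B Q × (Q ≤fq P))))

  Principal : ∀ {u} → Class u → ℕ → Set (a ⊔ r ⊔ s ⊔ u)
  Principal U k =
    Σ Problem λ S → U S × SCIis S k × (∀ P → O k U P ⇔ (U P × (S ≤fq P)))

  Incompatible : ∀ {u} → Class u → ℕ → Problem → Problem → Set (a ⊔ r ⊔ s ⊔ u)
  Incompatible U k O₀ O₁ =
      U O₀ × U O₁ × SCIis O₀ k × SCIis O₁ k
    × ¬ (Σ Problem λ S → U S × SCIis S k × (S ≤fq O₀) × (S ≤fq O₁))

  FiniteClass : ∀ {b} → Class b → Set (a ⊔ b)
  FiniteClass B = Σ (List Problem) λ bs → ∀ P → B P → P ∈ bs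

  InfiniteFamily : Set a
  InfiniteFamily = Σ (ℕ → Problem) λ f → ∀ i j → f i ≡ f j → i ≡ j

{-# OPTIONS --safe #-}
-- Every member of a basis lies in O_k(U), and every member of O_k(U) sits above some basis
-- member. (1) A generator of a principal O_k(U) would lie below both incompatible basis
-- members. (2) Choose for each member of the family a basis member below it; if the basis
-- is finite, the pigeonhole principle makes two distinct family members share that lower
-- bound.
module Submission where

open import Defs
open import Level using (Level)
open import Data.Nat using (ℕ; suc; _<_)
open import Data.Nat.Properties using (n<1+n; <⇒≢)
open import Data.Product using (Σ; _×_; _,_; proj₁; proj₂)
open import Data.Fin using (Fin; toℕ)
open import Data.Fin.Properties using (pigeonhole)
open import Data.List using (List; length; lookup)
open import Data.List.Membership.Propositional using (_∈_)
open import Data.List.Relation.Unary.Any using (index)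
open import Data.List.Relation.Unary.Any.Properties using (lookup-index)
open import Relation.Nullary using (¬_)
open import Relation.Binary.PropositionalEquality using (_≡_; _≢_; cong; sym; subst; module ≡-Reasoning)
open import Function.Bundles using (Equivalence)

module _ {a} {A : Set a} where

  finiteRange⇒collision : (xs : List A) (g : ℕ → A) → (∀ n → g n ∈ xs) →
    Σ ℕ λ i → Σ ℕ λ j → i < j × g i ≡ g j
  finiteRange⇒collision xs g g∈xs
    with i , j , i<j , same-position ← pigeonhole (n<1+n (length xs)) (λ m → index (g∈xs (toℕ m))) =
    toℕ i , toℕ j , i<j , (begin
      g (toℕ i)                              ≡⟨ lookup-index (g∈xs (toℕ i)) ⟩
      lookup xs (index (g∈xs (toℕ i)))       ≡⟨ cong (lookup xs) same-position ⟩
      lookup xs (index (g∈xs (toℕ j)))       ≡⟨ lookup-index (g∈xs (toℕ j)) ⟨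
      g (toℕ j)                              ∎)
    where open ≡-Reasoning

module _ {a r s : Level} (T : ProblemTheory a r s) where
  open ProblemTheory T

  module _ {u} (U : Class T u) (k : ℕ) where

    basisMember⇒O : ∀ {b} {B : Class T b} → IsExactBasis T U k B → ∀ {Q} → B Q → O T k U Q
    basisMember⇒O (B⊆U , B-SCI , _) {Q} Q∈B = B⊆U Q Q∈B , B-SCI Q Q∈B

    O⇒aboveBasisMember : ∀ {b} {B : Class T b} → IsExactBasis T U k B →
      ∀ {P} → O T k U P → Σ Problem λ Q → B Q × (Q ≤fq P)
    O⇒aboveBasisMember (_ , _ , O⇔above) {P} P∈O = proj₂ (Equivalence.to (O⇔above P) P∈O)

    generator-O : (p : Principal T U k) → O T k U (proj₁ p)
    generator-O (_ , S∈U , S-SCI , _) = S∈U , S-SCI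

    generator-≤fq : (p : Principal T U k) → ∀ {P} → O T k U P → proj₁ p ≤fq P
    generator-≤fq (_ , _ , _ , O⇔above) {P} P∈O = proj₂ (Equivalence.to (O⇔above P) P∈O)

    incompatible⇒no-common-lower : ∀ {O₀ O₁} → Incompatible T U k O₀ O₁ →
      ∀ {S} → O T k U S → S ≤fq O₀ → ¬ (S ≤fq O₁)
    incompatible⇒no-common-lower (_ , _ , _ , _ , no-lower) (S∈U , S-SCI) S≤O₀ S≤O₁ =
      no-lower (_ , S∈U , S-SCI , S≤O₀ , S≤O₁)

    principal⇒¬incompatible : Principal T U k → ∀ {O₀ O₁} → O T k U O₀ → O T k U O₁ →
      ¬ Incompatible T U k O₀ O₁
    principal⇒¬incompatible p O₀∈O O₁∈O incompatible =
      incompatible⇒no-common-lower incompatible (generator-O p)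
        (generator-≤fq p O₀∈O) (generator-≤fq p O₁∈O)

    basisLowerBounds : ∀ {b} {B : Class T b} → IsExactBasis T U k B →
      (f : ℕ → Problem) → (∀ n → O T k U (f n)) →
      Σ (ℕ → Problem) λ q → (∀ n → B (q n)) × (∀ n → q n ≤fq f n)
    basisLowerBounds {B = B} basis f f∈O =
      (λ n → proj₁ (above n)) , (λ n → proj₁ (proj₂ (above n))) , (λ n → proj₂ (proj₂ (above n)))
      where
      above : ∀ n → Σ Problem λ Q → B Q × (Q ≤fq f n)
      above n = O⇒aboveBasisMember basis (f∈O n)

    finiteBasis⇒shared-lower : ∀ {b} {B : Class T b} → IsExactBasis T U k B → FiniteClass T B →
      (f : ℕ → Problem) → (∀ n → O T k U (f n)) →
      Σ ℕ λ i → Σ ℕ λ j → i < j × Σ Problem λ Q → O T k U Q × (Q ≤fq f i) × (Q ≤fq f j)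
    finiteBasis⇒shared-lower basis (bs , B⊆bs) f f∈O
      with q , q∈B , q≤f ← basisLowerBounds basis f f∈O
      with i , j , i<j , qi≡qj ← finiteRange⇒collision bs q (λ n → B⊆bs (q n) (q∈B n)) =
      i , j , i<j , q i , basisMember⇒O basis (q∈B i) , q≤f i , subst (_≤fq f j) (sym qi≡qj) (q≤f j)

    incompatibleBasisMembers⇒¬principal : ∀ {b} {B : Class T b} → IsExactBasis T U k B →
      ∀ {O₀ O₁} → B O₀ → B O₁ → Incompatible T U k O₀ O₁ → ¬ Principal T U k
    incompatibleBasisMembers⇒¬principal basis O₀∈B O₁∈B incompatible p =
      principal⇒¬incompatible p (basisMember⇒O basis O₀∈B) (basisMember⇒O basis O₁∈B) incompatible

    incompatibleFamily⇒¬finiteBasis : ∀ {b} (F : InfiniteFamily T) → (∀ n → O T k U (proj₁ F n)) →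
      (∀ i j → proj₁ F i ≢ proj₁ F j → Incompatible T U k (proj₁ F i) (proj₁ F j)) →
      (B : Class T b) → IsExactBasis T U k B → ¬ FiniteClass T B
    incompatibleFamily⇒¬finiteBasis (f , f-injective) f∈O f-incompatible B basis finite
      with i , j , i<j , Q , Q∈O , Q≤fi , Q≤fj ← finiteBasis⇒shared-lower basis finite f f∈O =
      incompatible⇒no-common-lower
        (f-incompatible i j (λ fi≡fj → <⇒≢ i<j (f-injective i j fi≡fj))) Q∈O Q≤fi Q≤fj

theorem4p25 : ∀ {a r s u b : Level} (T : ProblemTheory a r s) (U : Class T u) (k : ℕ) →
    -- (1)
    ((B : Class T b) → IsExactBasis T U k B →
      (Σ (ProblemTheory.Problem T) λ O₀ → Σ (ProblemTheory.Problem T) λ O₁ →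
        B O₀ × B O₁ × O₀ ≢ O₁ × Incompatible T U k O₀ O₁) →
      ¬ Principal T U k)
    ×
    -- (2)
    ((F : InfiniteFamily T) →
      (∀ n → O T k U (proj₁ F n)) →
      (∀ i j → proj₁ F i ≢ proj₁ F j → Incompatible T U k (proj₁ F i) (proj₁ F j)) →
      (B : Class T b) → IsExactBasis T U k B → ¬ FiniteClass T B)
theorem4p25 T U k =
  (λ { _ basis (_ , _ , O₀∈B , O₁∈B , _ , incompatible) →
         incompatibleBasisMembers⇒¬principal T U k basis O₀∈B O₁∈B incompatible }) ,
  incompatibleFamily⇒¬finiteBasis T U k
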